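{- For all integers $k\geq 3$ and $r\geq 2$ we have $h_r(k)\geq \max\{f(k), g_r(k)\}$.
   Context: A $k$-graph is a hypergraph all of whose edges have exactly $k$ vertices. For a $k$-graph $H$ and a vertex $x$, $d_H(x)$ is the number of edges containing $x$, and $\delta(H)=\min_x d_H(x)$ is the minimum vertex degree. A perfect matching is a set of pairwise disjoint edges covering all vertices. For $n\equiv 0\pmod k$, let $m(k,n)$ be the smallest integer $m$ such that every $n$-vertex $k$-graph $H$ with $\delta(H)\geq m$ has a perfect matching, and let $f(k)=\limsup_{n\to\infty} m(k,n)/\binom{n-1}{k-1}$. For integers $r\geq 2$, $k\geq 2$, $h_r(k)$ is the smallest constant $h>0$ such that for every $\epsilon>0$ there is $\delta=\delta(\epsilon,r,k)>0$ with the following property: for every sufficiently large $n$ with $n\equiv 0\pmod k$, every $n$-vertex $k$-graph $H$ with $\delta(H)\geq (h+\epsilon)\binom{n-1}{k-1}$ and every coloring of $E(H)$ with $r$ colors, there is a perfect matching of $H$ having at least $\frac{n}{rk}+\delta n$ edges of the same color. Let $\mathbb{N}^r_{k-1}$ be the set of integer vectors $\vec{\mathbf a}=(a_1,\dots,a_r)$ with $0\leq a_1\leq a_2\leq\dots\leq a_r$ and $a_1+\dots+a_r=k-1$. For $n$ divisible by $rk$ and $\vec{\mathbf a}\in\mathbb{N}^r_{k-1}$, $H(n,\vec{\mathbf a})$ is the $k$-graph on a vertex set partitioned as $V_1\cup\dots\cup V_r$ with $|V_i|=\frac{ra_i+1}{rk}n$, whose edges are all $k$-sets $e$ for which there is $i\in[r]$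 with $|e\cap V_i|=a_i+1$ and $|e\cap V_j|=a_j$ for all $j\neq i$. Define $g_r(k)=\max_{\vec{\mathbf a}\in\mathbb{N}^r_{k-1}} \lim_{n\to\infty,\ rk\mid n} \delta(H(n,\vec{\mathbf a}))/\binom{n-1}{k-1}$.
   Formalization: The constant h and the parameters ε and δ in the definition of $h_r(k)$ are taken rational, and f(k) and g_r(k) are compared only with such rational h. -}

module Defs where

open import Data.Bool using (Bool; true; false; _∧_; T)
open import Data.Nat as ℕ using (ℕ; zero; suc; _∸_; _≡ᵇ_; _*_)
open import Data.Nat.Combinatorics using (_C_)
open import Data.Nat.Divisibility using () renaming (_∣_ to _divides_)
open import Data.Fin using (Fin; toℕ)
open import Data.Fin.Subset using (Subset; _∩_; ⊥; ∣_∣)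
open import Data.Vec as Vec using (Vec; []; _∷_; lookup; tabulate)
open import Data.List as List using (List; []; _∷_; length; filter; map; _++_; allFin)
open import Data.List.Relation.Unary.All using (All)
open import Data.List.Relation.Unary.Any using (Any)
open import Data.List.Relation.Unary.AllPairs using (AllPairs)
open import Data.Integer using (+_)
open import Data.Rational as ℚ using (ℚ; 0ℚ; _≤_; _<_; _+_)
open import Data.Product using (Σ; _×_; ∃)
open import Relation.Binary.PropositionalEquality using (_≡_)
open import Relation.Nullary.Decidable using (Dec; T?)

⟦_⟧ : ℕ → ℚ
⟦ m ⟧ = (+ m) ℚ./ 1

-- m / d as a rational (d = 0 is never used: we only apply it with d = r*k > 0)
frac : ℕ → ℕ → ℚ
frac m zero    = 0ℚ
frac m (suc d) = (+ m) ℚ./ suc d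

binom : ℕ → ℕ → ℚ
binom n k = ⟦ (n ∸ 1) C (k ∸ 1) ⟧

allSubsets : (n : ℕ) → List (Subset n)
allSubsets zero    = [] ∷ []
allSubsets (suc n) = map (false ∷_) (allSubsets n) ++ map (true ∷_) (allSubsets n)

-- A k-graph on Fin n: a Boolean predicate on subsets; its edges are exactly
-- the k-element subsets e with H e = true (other subsets are ignored).
record KGraph (k n : ℕ) : Set where
  constructor mkKGraph
  field
    edgeᵇ : Subset n → Bool

open KGraph public

isEdgeᵇ : {k n : ℕ} → KGraph k n → Subset n → Bool
isEdgeᵇ {k} H e = (∣ e ∣ ≡ᵇ k) ∧ edgeᵇ H e

IsEdge : {k n : ℕ} → KGraph k n → Subset n → Set
IsEdge H e = T (isEdgeᵇ H e)

degree : {k n : ℕ} → KGraph k n → Fin n → ℕ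
degree H x = length (filter (λ e → T? (isEdgeᵇ H e ∧ lookup e x)) (allSubsets _))

MinDegAtLeast : {k n : ℕ} → KGraph k n → ℕ → Set
MinDegAtLeast H t = ∀ x → t ℕ.≤ degree H x

MinDegAtLeastℚ : {k n : ℕ} → KGraph k n → ℚ → Set
MinDegAtLeastℚ H c = ∀ x → c ≤ ⟦ degree H x ⟧

-- δ(H) ≤ c for a rational c (for n ≥ 1: some vertex has degree ≤ c)
MinDegAtMostℚ : {k n : ℕ} → KGraph k n → ℚ → Set
MinDegAtMostℚ H c = ∃ λ x → ⟦ degree H x ⟧ ≤ c

Disjoint : {n : ℕ} → Subset n → Subset n → Set
Disjoint e f = e ∩ f ≡ ⊥

IsPerfectMatching : {k n : ℕ} → KGraph k n → List (Subset n) → Set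
IsPerfectMatching {n = n} H M =
  All (IsEdge H) M × AllPairs Disjoint M × (∀ (x : Fin n) → Any (λ e → T (lookup e x)) M)

HasPerfectMatching : {k n : ℕ} → KGraph k n → Set
HasPerfectMatching H = ∃ λ M → IsPerfectMatching H M

PMDegreeCondition : ℕ → ℕ → ℕ → Set
PMDegreeCondition k n m = (H : KGraph k n) → MinDegAtLeast H m → HasPerfectMatching H

IsMkn : ℕ → ℕ → ℕ → Set
IsMkn k n m = PMDegreeCondition k n m × (∀ m' → m' ℕ.< m → PMDegreeCondition k n m' → Data.Empty.⊥)
  where import Data.Empty

-- f(k) ≤ h  (f(k) = limsup_{n, k ∣ n} m(k,n) / binom(n-1,k-1))
fAtMost : ℕ → ℚ → Set
fAtMost k h = (ε : ℚ) → 0ℚ < ε → Σ ℕ λ N → (n : ℕ) → N ℕ.≤ n → k divides n →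
  (m : ℕ) → IsMkn k n m → ⟦ m ⟧ ≤ (h + ε) ℚ.* binom n k

InNrk : (r k : ℕ) → Vec ℕ r → Set
InNrk r k a = (∀ (i j : Fin r) → toℕ i ℕ.≤ toℕ j → lookup a i ℕ.≤ lookup a j)
            × Vec.sum a ≡ k ∸ 1

part : {r N : ℕ} → (Fin N → Fin r) → Fin r → Subset N
part p i = tabulate (λ x → toℕ (p x) ≡ᵇ toℕ i)

-- p is a partition V_1 ∪ ... ∪ V_r of Fin (r*k*t) with |V_i| = (r a_i + 1) t
-- (n = r k t, so |V_i| = (r a_i + 1) n / (r k))
IsHPartition : (r k t : ℕ) → Vec ℕ r → (Fin (r * k * t) → Fin r) → Set
IsHPartition r k t a p = ∀ (i : Fin r) → ∣ part p i ∣ ≡ (r * lookup a i ℕ.+ 1) * t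

anyᵇ : {A : Set} → (A → Bool) → List A → Bool
anyᵇ f xs = List.foldr (λ x b → f x ∨ b) false xs
  where open import Data.Bool using (_∨_)

allᵇ : {A : Set} → (A → Bool) → List A → Bool
allᵇ f xs = List.foldr (λ x b → f x ∧ b) true xs

Hna : {r k N : ℕ} → Vec ℕ r → (Fin N → Fin r) → KGraph k N
Hna {r} a p = mkKGraph λ e →
  anyᵇ (λ i → allᵇ (λ j →
      ∣ e ∩ part p j ∣ ≡ᵇ (lookup a j ℕ.+ (if toℕ i ≡ᵇ toℕ j then 1 else 0)))
    (allFin r)) (allFin r)
  where open import Data.Bool using (if_then_else_)

-- g_r(k) ≤ h : for every a ∈ ℕ^r_{k-1},  lim δ(H(n,a)) / binom(n-1,k-1) ≤ h
gAtMost : ℕ → ℕ → ℚ → Set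
gAtMost r k h = (a : Vec ℕ r) → InNrk r k a →
  (ε : ℚ) → 0ℚ < ε → Σ ℕ λ N → (t : ℕ) → N ℕ.≤ r * k * t →
  (p : Fin (r * k * t) → Fin r) → IsHPartition r k t a p →
  MinDegAtMostℚ (Hna {r} {k} a p) ((h + ε) ℚ.* binom (r * k * t) k)

colourCount : {r n : ℕ} → (Subset n → Fin r) → Fin r → List (Subset n) → ℕ
colourCount c i M = length (filter (λ e → T? (toℕ (c e) ≡ᵇ toℕ i)) M)

-- h has the defining property of h_r(k) (h_r(k) is the infimum of such h > 0)
HrkValid : ℕ → ℕ → ℚ → Set
HrkValid r k h = (ε : ℚ) → 0ℚ < ε → Σ ℚ λ δ → 0ℚ < δ × (Σ ℕ λ N →
  (n : ℕ) → N ℕ.≤ n → k divides n → (H : KGraph k n) →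
  MinDegAtLeastℚ H ((h + ε) ℚ.* binom n k) →
  (c : Subset n → Fin r) →
  ∃ λ M → IsPerfectMatching H M × ∃ λ i →
    frac n (r * k) + δ ℚ.* ⟦ n ⟧ ≤ ⟦ colourCount c i M ⟧)

{-# OPTIONS --safe #-}
module Submission where

open import Defs

-- Colour each edge of H(n, a), n = rkt, by its type: the part V_i that it meets in a_i + 1 vertices.
-- A perfect matching has n/k = rt edges and partitions the vertex set, so summing
-- |e ∩ V_j| = a_j + [type e = j] over it gives (r a_j + 1) t = |V_j| = rt a_j + #(edges of type j):
-- every colour class has exactly t = n/(rk) edges. Hence H(n, a) cannot satisfy the degree
-- hypothesis of h_r(k) with h + ε, which is g_r(k) ≤ h. Forgetting colours, that hypothesis says
-- that minimum degree (h + ε/2) C(n-1, k-1) forces a perfect matching; by minimality of m(k, n)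
-- this gives m(k, n) ≤ (h + ε/2) C(n-1, k-1) + 1 ≤ (h + ε) C(n-1, k-1) once C(n-1, k-1) ≥ 2/ε.

module DisjointSubsets where

  open import Data.Bool using (T)
  open import Data.Bool.Properties using (T-≡)
  open import Data.Nat using (suc; _+_; _*_)
  open import Data.Nat.Properties using (+-suc)
  open import Data.Fin.Subset
    using (Subset; inside; outside; _∈_; _⊆_; _∩_; _∪_; ⊤; ⋃; ∣_∣) renaming (⊥ to ∅)
  open import Data.Fin.Subset.Properties
  open import Data.Vec using (_∷_; []; lookup; tail)
  open import Data.Vec.Properties using (lookup⇒[]=)
  open import Data.List using (List; []; _∷_; length)
  open import Data.List.Relation.Unary.All using (All; []; _∷_)
  open import Data.List.Relation.Unary.Any using (Any; here; there)
  open import Data.List.Relation.Unary.AllPairs using (AllPairs; []; _∷_)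
  open import Data.Product using (_,_)
  open import Data.Sum using (inj₁; inj₂)
  open import Function using (Equivalence)
  open import Relation.Binary.PropositionalEquality

  ∣p∪q∣≡∣p∣+∣q∣ : ∀ {n} (p q : Subset n) → Disjoint p q → ∣ p ∪ q ∣ ≡ ∣ p ∣ + ∣ q ∣
  ∣p∪q∣≡∣p∣+∣q∣ []            []            _  = refl
  ∣p∪q∣≡∣p∣+∣q∣ (outside ∷ p) (outside ∷ q) pq = ∣p∪q∣≡∣p∣+∣q∣ p q (cong tail pq)
  ∣p∪q∣≡∣p∣+∣q∣ (outside ∷ p) (inside  ∷ q) pq =
    trans (cong suc (∣p∪q∣≡∣p∣+∣q∣ p q (cong tail pq))) (sym (+-suc ∣ p ∣ ∣ q ∣))
  ∣p∪q∣≡∣p∣+∣q∣ (inside  ∷ p) (outside ∷ q) pq = cong suc (∣p∪q∣≡∣p∣+∣q∣ p q (cong tail pq))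
  ∣p∪q∣≡∣p∣+∣q∣ (inside  ∷ p) (inside  ∷ q) ()

  Disjoint-⊆ : ∀ {n} {p q p′ q′ : Subset n} → p′ ⊆ p → q′ ⊆ q → Disjoint p q → Disjoint p′ q′
  Disjoint-⊆ {p′ = p′} {q′} p′⊆p q′⊆q pq = Empty-unique λ where
    (x , x∈p′∩q′) → let x∈p′ , x∈q′ = x∈p∩q⁻ p′ q′ x∈p′∩q′ in
      ∉⊥ (subst (x ∈_) pq (x∈p∩q⁺ (p′⊆p x∈p′ , q′⊆q x∈q′)))

  Disjoint-⋃ : ∀ {n} {p : Subset n} {M : List (Subset n)} → All (Disjoint p) M → Disjoint p (⋃ M)
  Disjoint-⋃ {p = p} []                = ∩-zeroʳ p
  Disjoint-⋃ {p = p} {q ∷ M} (pq ∷ pM) = begin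
    p ∩ (q ∪ ⋃ M)         ≡⟨ ∩-distribˡ-∪ p q (⋃ M) ⟩
    (p ∩ q) ∪ (p ∩ ⋃ M)   ≡⟨ cong₂ _∪_ pq (Disjoint-⋃ pM) ⟩
    ∅ ∪ ∅                 ≡⟨ ∪-idem ∅ ⟩
    ∅                     ∎
    where open ≡-Reasoning

  ∣⋃∣≡length*k : ∀ {n k} {M : List (Subset n)} → AllPairs Disjoint M → All (λ e → ∣ e ∣ ≡ k) M →
                 ∣ ⋃ M ∣ ≡ length M * k
  ∣⋃∣≡length*k {n}         []            []           = ∣⊥∣≡0 n
  ∣⋃∣≡length*k {k = k} {e ∷ M} (eM ∷ M-disj) (∣e∣ ∷ ∣M∣) = begin
    ∣ e ∪ ⋃ M ∣           ≡⟨ ∣p∪q∣≡∣p∣+∣q∣ e (⋃ M) (Disjoint-⋃ eM) ⟩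
    ∣ e ∣ + ∣ ⋃ M ∣       ≡⟨ cong₂ _+_ ∣e∣ (∣⋃∣≡length*k M-disj ∣M∣) ⟩
    k + length M * k      ∎
    where open ≡-Reasoning

  ∣[e∪⋃M]∩s∣≡∣e∩s∣+∣⋃M∩s∣ : ∀ {n} {e s : Subset n} {M : List (Subset n)} → All (Disjoint e) M →
                            ∣ (e ∪ ⋃ M) ∩ s ∣ ≡ ∣ e ∩ s ∣ + ∣ ⋃ M ∩ s ∣
  ∣[e∪⋃M]∩s∣≡∣e∩s∣+∣⋃M∩s∣ {e = e} {s} {M} eM = begin
    ∣ (e ∪ ⋃ M) ∩ s ∣          ≡⟨ cong ∣_∣ (∩-distribʳ-∪ s e (⋃ M)) ⟩
    ∣ (e ∩ s) ∪ (⋃ M ∩ s) ∣    ≡⟨ ∣p∪q∣≡∣p∣+∣q∣ (e ∩ s) (⋃ M ∩ s) restricted-disjoint ⟩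
    ∣ e ∩ s ∣ + ∣ ⋃ M ∩ s ∣    ∎
    where
    open ≡-Reasoning
    restricted-disjoint : Disjoint (e ∩ s) (⋃ M ∩ s)
    restricted-disjoint = Disjoint-⊆ (p∩q⊆p e s) (p∩q⊆p (⋃ M) s) (Disjoint-⋃ eM)

  covering⇒⋃≡⊤ : ∀ {n} (M : List (Subset n)) → (∀ x → Any (λ e → T (lookup e x)) M) → ⋃ M ≡ ⊤
  covering⇒⋃≡⊤ M covers = ⊆-antisym ⊆⊤ (λ {x} _ → ∈⋃ (covers x))
    where
    ∈⋃ : ∀ {x} {N : List (Subset _)} → Any (λ e → T (lookup e x)) N → x ∈ ⋃ N
    ∈⋃ {x} (here {e} x∈e) = x∈p∪q⁺ (inj₁ (lookup⇒[]= x e (Equivalence.to T-≡ x∈e)))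
    ∈⋃      (there x∈N)   = x∈p∪q⁺ (inj₂ (∈⋃ x∈N))

module PerfectMatchings where

  open DisjointSubsets
  open import Data.Bool using (Bool; true; false; T; if_then_else_)
  open import Data.Bool.Properties using (T-∧)
  open import Data.Nat using (ℕ; suc; _+_; _*_; _≡ᵇ_)
  open import Data.Nat.Properties using (≡ᵇ⇒≡; +-cancelˡ-≡; *-cancelʳ-≡)
  open import Data.Nat.Solver using (module +-*-Solver)
  open import Data.Fin using (Fin; toℕ; zero)
  open import Data.Fin.Subset using (Subset; _∩_; _∪_; ⊤; ⋃; ∣_∣)
  open import Data.Fin.Subset.Properties using (∣⊤∣≡n; ∣⊥∣≡0; ∩-zeroˡ; ∩-identityˡ)
  open import Data.Vec using (Vec; lookup)
  open import Data.List using (List; []; _∷_; length; allFin; findᵇ)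
  open import Data.List.Membership.Propositional.Properties using (∈-allFin)
  open import Data.List.Relation.Unary.All as All using (All; []; _∷_)
  open import Data.List.Relation.Unary.AllPairs using (AllPairs; []; _∷_)
  open import Data.Maybe using (fromMaybe)
  open import Data.Product using (_,_; proj₁; proj₂)
  open import Function using (Equivalence)
  open import Relation.Binary.PropositionalEquality

  IsEdge⇒∣e∣≡k : ∀ {k n} (H : KGraph k n) {e : Subset n} → IsEdge H e → ∣ e ∣ ≡ k
  IsEdge⇒∣e∣≡k H {e} e∈H = ≡ᵇ⇒≡ ∣ e ∣ _ (proj₁ (Equivalence.to T-∧ e∈H))

  IsPerfectMatching⇒⋃≡⊤ : ∀ {k n} {H : KGraph k n} {M} → IsPerfectMatching H M → ⋃ M ≡ ⊤
  IsPerfectMatching⇒⋃≡⊤ {M = M} (_ , _ , covers) = covering⇒⋃≡⊤ M covers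

  IsPerfectMatching⇒length*k≡n : ∀ {k n} (H : KGraph k n) {M} → IsPerfectMatching H M → length M * k ≡ n
  IsPerfectMatching⇒length*k≡n {k} {n} H {M} pm@(edges , disjoint , _) = begin
    length M * k   ≡⟨ ∣⋃∣≡length*k disjoint (All.map (IsEdge⇒∣e∣≡k H) edges) ⟨
    ∣ ⋃ M ∣        ≡⟨ cong ∣_∣ (IsPerfectMatching⇒⋃≡⊤ pm) ⟩
    ∣ ⊤ {n} ∣      ≡⟨ ∣⊤∣≡n n ⟩
    n              ∎
    where open ≡-Reasoning

  allᵇ⇒All : ∀ {A : Set} (f : A → Bool) (xs : List A) → T (allᵇ f xs) → All (λ x → T (f x)) xs
  allᵇ⇒All f []       _   = []
  allᵇ⇒All f (x ∷ xs) fx∧rest with f x in fx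
  ... | true = subst T (sym fx) _ ∷ allᵇ⇒All f xs fx∧rest

  anyᵇ⇒findᵇ-satisfies : ∀ {A : Set} (f : A → Bool) (d : A) (xs : List A) →
                         T (anyᵇ f xs) → T (f (fromMaybe d (findᵇ f xs)))
  anyᵇ⇒findᵇ-satisfies f d (x ∷ xs) fx∨rest with f x in fx
  ... | true  = subst T (sym fx) _
  ... | false = anyᵇ⇒findᵇ-satisfies f d xs fx∨rest

  indicator : Bool → ℕ
  indicator b = if b then 1 else 0

  -- hasType a p e i is the i-th disjunct of the edge predicate of Hna a p.
  hasType : ∀ {r N} → Vec ℕ r → (Fin N → Fin r) → Subset N → Fin r → Bool
  hasType {r} a p e i =
    allᵇ (λ j → ∣ e ∩ part p j ∣ ≡ᵇ (lookup a j + indicator (toℕ i ≡ᵇ toℕ j))) (allFin r)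

  -- The default 0 is only taken by non-edges.
  edgeType : ∀ {r N} → Vec ℕ (suc r) → (Fin N → Fin (suc r)) → Subset N → Fin (suc r)
  edgeType a p e = fromMaybe zero (findᵇ (hasType a p e) (allFin _))

  Hna-edge-∩part : ∀ {r k N} (a : Vec ℕ (suc r)) (p : Fin N → Fin (suc r)) (e : Subset N) →
                   IsEdge (Hna {k = k} a p) e →
                   ∀ j → ∣ e ∩ part p j ∣ ≡ lookup a j + indicator (toℕ (edgeType a p e) ≡ᵇ toℕ j)
  Hna-edge-∩part a p e e∈H j =
    ≡ᵇ⇒≡ _ _ (All.lookup (allᵇ⇒All _ (allFin _) typed) (∈-allFin j))
    where
    typed : T (hasType a p e (edgeType a p e))
    typed = anyᵇ⇒findᵇ-satisfies (hasType a p e) zero (allFin _) (proj₂ (Equivalence.to T-∧ e∈H))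

  colourCount-∷ : ∀ {r n} (c : Subset n → Fin r) (j : Fin r) (e : Subset n) (M : List (Subset n)) →
                  colourCount c j (e ∷ M) ≡ indicator (toℕ (c e) ≡ᵇ toℕ j) + colourCount c j M
  colourCount-∷ c j e M with toℕ (c e) ≡ᵇ toℕ j
  ... | true  = refl
  ... | false = refl

  ∣⋃∩part∣≡length*a+colourCount :
    ∀ {r k N} (a : Vec ℕ (suc r)) (p : Fin N → Fin (suc r)) {M : List (Subset N)} →
    AllPairs Disjoint M → All (IsEdge (Hna {k = k} a p)) M →
    ∀ j → ∣ ⋃ M ∩ part p j ∣ ≡ length M * lookup a j + colourCount (edgeType a p) j M
  ∣⋃∩part∣≡length*a+colourCount {N = N} a p [] [] j = trans (cong ∣_∣ (∩-zeroˡ (part p j))) (∣⊥∣≡0 N)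
  ∣⋃∩part∣≡length*a+colourCount a p {e ∷ M} (eM ∷ M-disj) (e∈H ∷ M⊆H) j = begin
    ∣ (e ∪ ⋃ M) ∩ V ∣                        ≡⟨ ∣[e∪⋃M]∩s∣≡∣e∩s∣+∣⋃M∩s∣ eM ⟩
    ∣ e ∩ V ∣ + ∣ ⋃ M ∩ V ∣                  ≡⟨ cong₂ _+_ (Hna-edge-∩part a p e e∈H j)
                                                          (∣⋃∩part∣≡length*a+colourCount a p M-disj M⊆H j) ⟩
    (aⱼ + [e]) + (length M * aⱼ + count M)   ≡⟨ solve 4 (λ aⱼ [e] l c → (aⱼ :+ [e]) :+ (l :* aⱼ :+ c)
                                                                     := (aⱼ :+ l :* aⱼ) :+ ([e] :+ c))
                                                          refl aⱼ [e] (length M) (count M) ⟩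
    (aⱼ + length M * aⱼ) + ([e] + count M)   ≡⟨ cong (aⱼ + length M * aⱼ +_)
                                                          (colourCount-∷ (edgeType a p) j e M) ⟨
    length (e ∷ M) * aⱼ + count (e ∷ M)      ∎
    where
    open ≡-Reasoning
    open +-*-Solver
    V : Subset _
    V = part p j
    aⱼ [e] : ℕ
    aⱼ = lookup a j
    [e] = indicator (toℕ (edgeType a p e) ≡ᵇ toℕ j)
    count : List (Subset _) → ℕ
    count = colourCount (edgeType a p) j

  colourCount-edgeType≡t : ∀ {r k t} (a : Vec ℕ (suc r)) (p : Fin (suc r * suc k * t) → Fin (suc r)) →
                           IsHPartition (suc r) (suc k) t a p →
                           ∀ {M} → IsPerfectMatching (Hna {k = suc k} a p) M →
                           ∀ j → colourCount (edgeType a p) j M ≡ t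
  colourCount-edgeType≡t {r} {k} {t} a p partition {M} pm@(edges , disjoint , _) j =
    +-cancelˡ-≡ (suc r * t * aⱼ) _ _ (begin
      suc r * t * aⱼ + count       ≡⟨ cong (λ l → l * aⱼ + count) length≡r*t ⟨
      length M * aⱼ + count        ≡⟨ ∣⋃∩part∣≡length*a+colourCount a p disjoint edges j ⟨
      ∣ ⋃ M ∩ V ∣                  ≡⟨ cong (λ U → ∣ U ∩ V ∣) (IsPerfectMatching⇒⋃≡⊤ pm) ⟩
      ∣ ⊤ ∩ V ∣                    ≡⟨ cong ∣_∣ (∩-identityˡ V) ⟩
      ∣ V ∣                        ≡⟨ partition j ⟩
      (suc r * aⱼ + 1) * t         ≡⟨ solve 3 (λ r a t → (r :* a :+ con 1) :* t := r :* t :* a :+ t)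
                                             refl (suc r) aⱼ t ⟩
      suc r * t * aⱼ + t           ∎)
    where
    open ≡-Reasoning
    open +-*-Solver
    V : Subset (suc r * suc k * t)
    V = part p j
    aⱼ count : ℕ
    aⱼ = lookup a j
    count = colourCount (edgeType a p) j M
    length≡r*t : length M ≡ suc r * t
    length≡r*t = *-cancelʳ-≡ (length M) (suc r * t) (suc k)
      (trans (IsPerfectMatching⇒length*k≡n (Hna a p) pm)
             (solve 3 (λ r k t → r :* k :* t := r :* t :* k) refl (suc r) (suc k) t))

module Arithmetic where

  open import Data.Nat as ℕ using (ℕ; zero; suc; z≤n; s≤s)
  import Data.Nat.Properties as ℕ
  open import Data.Nat.Combinatorics using (_C_; nC1≡n; nCk+nC[k+1]≡[n+1]C[k+1])
  open import Data.Nat.Coprimality using (1-coprimeTo) renaming (sym to coprime-sym)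
  open import Data.Integer as ℤ using (+_; -[1+_])
  import Data.Integer.Properties as ℤ
  open import Data.Rational
    using (ℚ; mkℚ; 0ℚ; 1ℚ; _+_; _*_; _/_; _≤_; _<_; 1/_; *≤*; positive; nonNegative; Positive; NonNegative; NonZero)
  open import Data.Rational.Properties
  import Data.Rational.Unnormalised as ℚᵘ
  open import Data.Product using (∃; _,_; proj₁; proj₂)
  open import Relation.Nullary using (¬_)
  open import Relation.Binary.PropositionalEquality

  ⟦⟧≡mkℚ : ∀ m → ⟦ m ⟧ ≡ mkℚ (+ m) 0 (coprime-sym (1-coprimeTo m))
  ⟦⟧≡mkℚ m = normalize-coprime (coprime-sym (1-coprimeTo m))

  ⟦⟧-mono-≤ : ∀ {m n} → m ℕ.≤ n → ⟦ m ⟧ ≤ ⟦ n ⟧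
  ⟦⟧-mono-≤ {m} {n} m≤n rewrite ⟦⟧≡mkℚ m | ⟦⟧≡mkℚ n =
    *≤* (subst₂ ℤ._≤_ (sym (ℤ.*-identityʳ (+ m))) (sym (ℤ.*-identityʳ (+ n))) (ℤ.+≤+ m≤n))

  ⟦⟧-nonNeg : ∀ m → 0ℚ ≤ ⟦ m ⟧
  ⟦⟧-nonNeg m = ⟦⟧-mono-≤ {0} {m} z≤n

  ⟦⟧-pos : ∀ {m} → 0 ℕ.< m → 0ℚ < ⟦ m ⟧
  ⟦⟧-pos {suc m} _ = positive⁻¹ ⟦ suc m ⟧ {{normalize-pos (suc m) 1}}

  ⟦1+m⟧≡⟦m⟧+1 : ∀ m → ⟦ suc m ⟧ ≡ ⟦ m ⟧ + 1ℚ
  ⟦1+m⟧≡⟦m⟧+1 m = sym (trans (cong (_+ 1ℚ) (⟦⟧≡mkℚ m)) (cong (_/ 1) numerator))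
    where
    numerator : + m ℤ.* + 1 ℤ.+ + 1 ℤ.* + 1 ≡ + suc m
    numerator rewrite ℤ.*-identityʳ (+ m) = trans (sym (ℤ.pos-+ m 1)) (cong +_ (ℕ.+-comm m 1))

  archimedean : ∀ q → ∃ λ K → q ≤ ⟦ K ⟧
  archimedean q@(mkℚ (+ m) d _) = m , subst (q ≤_) (sym (⟦⟧≡mkℚ m)) (*≤* m≤m*d)
    where
    m≤m*d : + m ℤ.* + 1 ℤ.≤ + m ℤ.* + suc d
    m≤m*d rewrite ℤ.*-identityʳ (+ m) | sym (ℤ.pos-* m (suc d)) = ℤ.+≤+ (ℕ.m≤m*n m (suc d))
  archimedean q@(mkℚ -[1+ m ] d _) = 0 , <⇒≤ (negative⁻¹ q)

  frac[m*t,m]≡⟦t⟧ : ∀ d t → frac (suc d ℕ.* t) (suc d) ≡ ⟦ t ⟧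
  frac[m*t,m]≡⟦t⟧ d t = fromℚᵘ-cong {ℚᵘ.mkℚᵘ (+ (suc d ℕ.* t)) d} {ℚᵘ.mkℚᵘ (+ t) 0} (ℚᵘ.*≡* cross)
    where
    cross : + (suc d ℕ.* t) ℤ.* + 1 ≡ + t ℤ.* + suc d
    cross rewrite ℤ.*-identityʳ (+ (suc d ℕ.* t)) = trans (cong +_ (ℕ.*-comm (suc d) t)) (ℤ.pos-* t (suc d))

  k≤n⇒0<nCk : ∀ {n k} → k ℕ.≤ n → 0 ℕ.< n C k
  k≤n⇒0<nCk {n}     {zero}  _         = s≤s z≤n
  k≤n⇒0<nCk {suc n} {suc k} (s≤s k≤n) rewrite sym (nCk+nC[k+1]≡[n+1]C[k+1] n k) =
    ℕ.≤-trans (k≤n⇒0<nCk k≤n) (ℕ.m≤m+n _ _)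

  0<k<n⇒n≤nCk : ∀ {n k} → 0 ℕ.< k → k ℕ.< n → n ℕ.≤ n C k
  0<k<n⇒n≤nCk {suc n} {1}           _ _ rewrite sym (nCk+nC[k+1]≡[n+1]C[k+1] n 0) | nC1≡n n = ℕ.≤-refl
  0<k<n⇒n≤nCk {suc n} {suc (suc k)} _ (s≤s k<n) rewrite sym (nCk+nC[k+1]≡[n+1]C[k+1] n (suc k)) =
    subst (ℕ._≤ n C suc k ℕ.+ n C suc (suc k)) (ℕ.+-comm n 1)
          (ℕ.+-mono-≤ (0<k<n⇒n≤nCk (s≤s z≤n) k<n) (k≤n⇒0<nCk k<n))

  p+q≰p : ∀ {p q} → 0ℚ < q → ¬ (p + q ≤ p)
  p+q≰p {p} {q} q>0 p+q≤p = <-irrefl refl (<-≤-trans p<p+q p+q≤p)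
    where
    p<p+q : p < p + q
    p<p+q = subst (_< p + q) (+-identityʳ p) (+-monoʳ-< p q>0)

  p*⟦n⟧>0 : ∀ {p n} → 0ℚ < p → 0 ℕ.< n → 0ℚ < p * ⟦ n ⟧
  p*⟦n⟧>0 {p} {n} p>0 n>0 =
    positive⁻¹ (p * ⟦ n ⟧) {{pos*pos⇒pos p {{positive p>0}} ⟦ n ⟧ {{positive (⟦⟧-pos n>0)}}}}

  eventually-1≤ε*binom : ∀ {k} → 2 ℕ.≤ k → (ε : ℚ) → 0ℚ < ε → ∃ λ N → ∀ n → N ℕ.≤ n → 1ℚ ≤ ε * binom n k
  eventually-1≤ε*binom {k@(suc (suc k′))} (s≤s (s≤s _)) ε ε>0 = suc (K ℕ.+ k) , large
    where
    instance
      ε-positive : Positive ε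
      ε-positive = positive ε>0
      ε-nonZero : NonZero ε
      ε-nonZero = pos⇒nonZero ε
      ε-nonNegative : NonNegative ε
      ε-nonNegative = nonNegative (<⇒≤ ε>0)
    K : ℕ
    K = proj₁ (archimedean (1/ ε))
    large : ∀ n → suc (K ℕ.+ k) ℕ.≤ n → 1ℚ ≤ ε * binom n k
    large (suc n) (s≤s K+k≤n) = begin
      1ℚ                    ≡⟨ *-inverseʳ ε ⟨
      ε * 1/ ε              ≤⟨ *-monoˡ-≤-nonNeg ε (proj₂ (archimedean (1/ ε))) ⟩
      ε * ⟦ K ⟧             ≤⟨ *-monoˡ-≤-nonNeg ε (⟦⟧-mono-≤ {K} {n C suc k′} K≤nCk) ⟩
      ε * ⟦ n C suc k′ ⟧    ∎
      where
      open ≤-Reasoning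
      K≤nCk : K ℕ.≤ n C suc k′
      K≤nCk = ℕ.≤-trans (ℕ.≤-trans (ℕ.m≤m+n K k) K+k≤n)
                        (0<k<n⇒n≤nCk (s≤s z≤n) (ℕ.≤-trans (ℕ.m≤n+m k K) K+k≤n))

module Thresholds where

  open PerfectMatchings using (edgeType; colourCount-edgeType≡t)
  open Arithmetic
  open import Data.Nat as ℕ using (ℕ; zero; suc; z≤n; s≤s; _∸_)
  import Data.Nat.Properties as ℕ
  open import Data.Nat.Combinatorics using (_C_)
  open import Data.Nat.Divisibility using (n∣m*n*o) renaming (_∣_ to _divides_)
  open import Data.Fin using (zero)
  open import Data.Fin.Properties using (¬∀⟶∃¬)
  open import Data.Rational using (ℚ; 0ℚ; 1ℚ; ½; _+_; _*_; _≤_; _<_; positive; nonNegative)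
  open import Data.Rational.Properties
  open import Data.Product using (Σ; _,_; proj₁; proj₂)
  open import Data.Sum using ([_,_]′)
  open import Relation.Nullary using (¬_; contradiction)
  open import Relation.Binary.PropositionalEquality

  ¬MinDegAtLeast⇒MinDegAtMost : ∀ {k n} (H : KGraph k n) (c : ℚ) → ¬ MinDegAtLeastℚ H c → MinDegAtMostℚ H c
  ¬MinDegAtLeast⇒MinDegAtMost {n = n} H c ¬deg≥ =
    let x , c≰deg = ¬∀⟶∃¬ n (λ x → c ≤ ⟦ degree H x ⟧) (λ x → c ≤? ⟦ degree H x ⟧) ¬deg≥
    in  x , <⇒≤ (≰⇒> c≰deg)

  PerfectMatchingThreshold : ℕ → ℚ → Set
  PerfectMatchingThreshold k h = (ε : ℚ) → 0ℚ < ε → Σ ℕ λ N →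
    (n : ℕ) → N ℕ.≤ n → k divides n → (H : KGraph k n) →
    MinDegAtLeastℚ H ((h + ε) * binom n k) → HasPerfectMatching H

  HrkValid⇒PerfectMatchingThreshold : ∀ {r k h} → HrkValid (suc r) k h → PerfectMatchingThreshold k h
  HrkValid⇒PerfectMatchingThreshold valid ε ε>0 =
    let _ , _ , N , colourful = valid ε ε>0 in
    N , λ n N≤n k∣n H deg≥ → let M , pm , _ = colourful n N≤n k∣n H deg≥ (λ _ → zero) in M , pm

  IsMkn⇒⟦m⟧≤q+1 : ∀ {k n m} → IsMkn k n m → (q : ℚ) → 0ℚ ≤ q →
                  (∀ (H : KGraph k n) → MinDegAtLeastℚ H q → HasPerfectMatching H) → ⟦ m ⟧ ≤ q + 1ℚ
  IsMkn⇒⟦m⟧≤q+1 {m = zero} _ q q≥0 _ =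
    nonNegative⁻¹ (q + 1ℚ) {{nonNeg+nonNeg⇒nonNeg q {{nonNegative q≥0}} 1ℚ}}
  IsMkn⇒⟦m⟧≤q+1 {k} {n} {suc m} (_ , minimal) q _ threshold =
    [ m+1≤q+1 , (λ q≤m → contradiction (m-suffices q≤m) (minimal m (ℕ.n<1+n m))) ]′ (≤-total ⟦ m ⟧ q)
    where
    m+1≤q+1 : ⟦ m ⟧ ≤ q → ⟦ suc m ⟧ ≤ q + 1ℚ
    m+1≤q+1 m≤q = subst (_≤ q + 1ℚ) (sym (⟦1+m⟧≡⟦m⟧+1 m)) (+-monoˡ-≤ 1ℚ m≤q)
    m-suffices : q ≤ ⟦ m ⟧ → PMDegreeCondition k n m
    m-suffices q≤m H deg≥m = threshold H (λ x → ≤-trans q≤m (⟦⟧-mono-≤ {m} {degree H x} (deg≥m x)))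

  PerfectMatchingThreshold⇒fAtMost : ∀ {k h} → 2 ℕ.≤ k → 0ℚ ≤ h → PerfectMatchingThreshold k h → fAtMost k h
  PerfectMatchingThreshold⇒fAtMost {k} {h} 2≤k h≥0 threshold ε ε>0 = N₁ ℕ.+ N₂ , bound
    where
    ε/2 : ℚ
    ε/2 = ε * ½
    ε/2>0 : 0ℚ < ε/2
    ε/2>0 = positive⁻¹ ε/2 {{pos*pos⇒pos ε {{positive ε>0}} ½}}
    N₁ N₂ : ℕ
    N₁ = proj₁ (threshold ε/2 ε/2>0)
    N₂ = proj₁ (eventually-1≤ε*binom 2≤k ε/2 ε/2>0)
    perfect : ∀ n → N₁ ℕ.≤ n → k divides n → (H : KGraph k n) →
              MinDegAtLeastℚ H ((h + ε/2) * binom n k) → HasPerfectMatching H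
    perfect = proj₂ (threshold ε/2 ε/2>0)
    1≤ε/2*B : ∀ n → N₂ ℕ.≤ n → 1ℚ ≤ ε/2 * binom n k
    1≤ε/2*B = proj₂ (eventually-1≤ε*binom 2≤k ε/2 ε/2>0)
    ε/2+ε/2≡ε : ε/2 + ε/2 ≡ ε
    ε/2+ε/2≡ε = trans (sym (*-distribˡ-+ ε ½ ½)) (*-identityʳ ε)
    halves : ∀ B → (h + ε/2) * B + ε/2 * B ≡ (h + ε) * B
    halves B = begin
      (h + ε/2) * B + ε/2 * B   ≡⟨ *-distribʳ-+ B (h + ε/2) ε/2 ⟨
      (h + ε/2 + ε/2) * B       ≡⟨ cong (_* B) (+-assoc h ε/2 ε/2) ⟩
      (h + (ε/2 + ε/2)) * B     ≡⟨ cong (λ e → (h + e) * B) ε/2+ε/2≡ε ⟩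
      (h + ε) * B               ∎
      where open ≡-Reasoning
    bound : (n : ℕ) → N₁ ℕ.+ N₂ ℕ.≤ n → k divides n → (m : ℕ) → IsMkn k n m → ⟦ m ⟧ ≤ (h + ε) * binom n k
    bound n N≤n k∣n m isMkn = begin
      ⟦ m ⟧                     ≤⟨ IsMkn⇒⟦m⟧≤q+1 isMkn ((h + ε/2) * B) q≥0 (perfect n N₁≤n k∣n) ⟩
      (h + ε/2) * B + 1ℚ        ≤⟨ +-monoʳ-≤ ((h + ε/2) * B) (1≤ε/2*B n N₂≤n) ⟩
      (h + ε/2) * B + ε/2 * B   ≡⟨ halves B ⟩
      (h + ε) * B               ∎
      where
      open ≤-Reasoning
      B : ℚ
      B = binom n k
      N₁≤n : N₁ ℕ.≤ n
      N₁≤n = ℕ.≤-trans (ℕ.m≤m+n N₁ N₂) N≤n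
      N₂≤n : N₂ ℕ.≤ n
      N₂≤n = ℕ.≤-trans (ℕ.m≤n+m N₂ N₁) N≤n
      q≥0 : 0ℚ ≤ (h + ε/2) * B
      q≥0 = nonNegative⁻¹ _ {{nonNeg*nonNeg⇒nonNeg (h + ε/2) {{nonNegative (+-mono-≤ h≥0 (<⇒≤ ε/2>0))}}
                                                    B {{nonNegative (⟦⟧-nonNeg ((n ∸ 1) C (k ∸ 1)))}}}}

  HrkValid⇒gAtMost : ∀ {r k h} → HrkValid (suc r) (suc k) h → gAtMost (suc r) (suc k) h
  HrkValid⇒gAtMost {r} {k} {h} valid a _ ε ε>0 =
    let δ , δ>0 , N , colourful = valid ε ε>0 in
    suc N , λ t N<n p partition → ¬MinDegAtLeast⇒MinDegAtMost (Hna a p) _ λ deg≥ →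
      let n = suc r ℕ.* suc k ℕ.* t
          M , pm , i , many = colourful n (ℕ.<⇒≤ N<n) (n∣m*n*o (suc r) t) (Hna a p) deg≥ (edgeType a p)
      in  p+q≰p (p*⟦n⟧>0 δ>0 (ℕ.≤-trans (s≤s z≤n) N<n))
                (subst₂ (λ x y → x + δ * ⟦ n ⟧ ≤ ⟦ y ⟧)
                        (frac[m*t,m]≡⟦t⟧ _ t) (colourCount-edgeType≡t a p partition pm i) many)

open Thresholds using (HrkValid⇒PerfectMatchingThreshold; PerfectMatchingThreshold⇒fAtMost; HrkValid⇒gAtMost)
open import Data.Nat using (ℕ; suc; _≤_; s≤s)
import Data.Nat.Properties as ℕ
open import Data.Rational using (ℚ; 0ℚ; _<_)
import Data.Rational.Properties as ℚ
open import Data.Product using (_×_; _,_)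

proposition1p3 : (k r : ℕ) → 3 ≤ k → 2 ≤ r →
    (h : ℚ) → 0ℚ < h → HrkValid r k h → fAtMost k h × gAtMost r k h
proposition1p3 (suc k) (suc r) 3≤k (s≤s _) h h>0 valid =
    PerfectMatchingThreshold⇒fAtMost {suc k} {h} (ℕ.<⇒≤ 3≤k) (ℚ.<⇒≤ h>0)
      (HrkValid⇒PerfectMatchingThreshold {r} {suc k} {h} valid)
  , HrkValid⇒gAtMost {r} {k} {h} valid
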